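{- Let $d\ge 3$ and $n\ge 1$ be integers, let $M$ be a Boolean $n\times n$ matrix and $u,v\in\{0,1\}^n$, and let $G$ be the graph constructed below. Let $\rho=\max_{\emptyset\ne S\subseteq V(G)}|E(S)|/|S|$ be the density of the densest subgraph of $G$. If $uMv=1$ then $\rho\ge d+\frac{1}{n^2+2n}$, and otherwise $\rho<d+\frac{1}{n^2+2n}$.
   Context: $uMv$ denotes the Boolean product $\bigvee_{i,j}(u_i\wedge M_{ij}\wedge v_j)$; $E(S)$ is the set of edges with both endpoints in $S$. A graph is $6$-edge connected if it stays connected after removing any $5$ edges. A vector gadget is a $6$-edge-connected $2d$-regular graph on $n$ nodes; a matrix gadget is a $6$-edge-connected $2d$-regular graph on $n^2$ nodes with one edge removed. The graph $G$ consists of: $2n$ vector gadgets $U_1,\dots,U_n,V_1,\dots,V_n$, with nodes of $U_i$ labelled $U_i[1],\dots,U_i[n]$ and of $V_j$ labelled $V_j[1],\dots,V_j[n]$; $n^2$ matrix gadgets $M_{ij}$ ($1\le i,j\le n$), the endpoints of the removed edge of $M_{ij}$ being labelled $M_{ij}[0]$ and $M_{ij}[1]$; edges $(U_i[j],M_{ij}[0])$ and $(V_j[i],M_{ij}[1])$ for all $i,j$. Then, depending on the input: for each $i,j$ with $M_{ij}=0$, one arbitrary edge of the matrix gadget $M_{ij}$ is removed; for each $i$ with $u_i=0$, two arbitrary edges of $U_i$ are removed; for each $j$ with $v_j=0$, two arbitrary edges of $V_j$ are removed. -}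

module Defs where

open import Data.Nat using (ℕ; zero; suc; _+_; _*_; _≤_; _<_)
open import Data.Bool using (Bool; true; false; _∧_; _∨_; not; if_then_else_)
open import Data.Fin using (Fin; zero; suc; toℕ; splitAt; remQuot; _≟_)
open import Data.Fin.Subset using (Subset; _∈_; ∣_∣; Nonempty)
open import Data.Nat using (_<ᵇ_)
open import Data.List using (List; []; _∷_; length)
open import Data.Product using (_×_; _,_; Σ; ∃; ∃-syntax)
open import Data.Sum using (inj₁; inj₂)
open import Data.Vec using (lookup)
open import Relation.Nullary.Decidable using (⌊_⌋)
open import Relation.Binary.PropositionalEquality using (_≡_)

Adj : ℕ → Set
Adj k = Fin k → Fin k → Bool

IsSimple : ∀ {k} → Adj k → Set
IsSimple {k} G = (∀ (x y : Fin k) → G x y ≡ G y x) × (∀ (x : Fin k) → G x x ≡ false)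

count : ∀ {k} → (Fin k → Bool) → ℕ
count {zero}  f = 0
count {suc k} f = (if f zero then 1 else 0) + count (λ x → f (suc x))

sumF : ∀ {k} → (Fin k → ℕ) → ℕ
sumF {zero}  f = 0
sumF {suc k} f = f zero + sumF (λ x → f (suc x))

anyF : ∀ {k} → (Fin k → Bool) → Bool
anyF {zero}  f = false
anyF {suc k} f = f zero ∨ anyF (λ x → f (suc x))

_==_ : ∀ {k} → Fin k → Fin k → Bool
x == y = ⌊ x ≟ y ⌋

degree : ∀ {k} → Adj k → Fin k → ℕ
degree G x = count (G x)

Regular : ∀ {k} → ℕ → Adj k → Set
Regular {k} r G = ∀ (x : Fin k) → degree G x ≡ r

-- |E(S)|: number of edges with both endpoints in S (each unordered
-- pair {x,y} counted once, via toℕ x < toℕ y)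
edgesIn : ∀ {k} → Adj k → Subset k → ℕ
edgesIn G S = sumF (λ x → count (λ y →
  (toℕ x <ᵇ toℕ y) ∧ lookup S x ∧ lookup S y ∧ G x y))

removeEdge : ∀ {k} → Adj k → Fin k → Fin k → Adj k
removeEdge G a b x y = G x y ∧ not ((x == a ∧ y == b) ∨ (x == b ∧ y == a))

removeEdges : ∀ {k} → Adj k → List (Fin k × Fin k) → Adj k
removeEdges G []            = G
removeEdges G ((a , b) ∷ es) = removeEdge (removeEdges G es) a b

data Reach {k} (G : Adj k) : Fin k → Fin k → Set where
  here : ∀ {x} → Reach G x x
  step : ∀ {x y z} → G x y ≡ true → Reach G y z → Reach G x z

Connected : ∀ {k} → Adj k → Set
Connected {k} G = ∀ (x y : Fin k) → Reach G x y

-- 6-edge-connected: stays connected after removing any 5 edges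
-- (removing a list of at most 5 pairs; pairs that are not edges remove nothing)
SixEdgeConnected : ∀ {k} → Adj k → Set
SixEdgeConnected {k} G =
  ∀ (es : List (Fin k × Fin k)) → length es ≤ 5 → Connected (removeEdges G es)

IsGadgetBase : ℕ → ∀ {k} → Adj k → Set
IsGadgetBase d G = IsSimple G × Regular (2 * d) G × SixEdgeConnected G

boolProd : ∀ {n} → (Fin n → Bool) → (Fin n → Fin n → Bool) → (Fin n → Bool) → Bool
boolProd u M v = anyF (λ i → anyF (λ j → u i ∧ M i j ∧ v j))

-- The graph G.  Vertices:
--   U i k  = U_i[k],   V j k = V_j[k],   Mn i j t = node t of matrix gadget M_ij

data GV (n : ℕ) : Set where
  Un : Fin n → Fin n → GV n
  Vn : Fin n → Fin n → GV n
  Mn : Fin n → Fin n → Fin (n * n) → GV n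

-- total number of nodes: n·n (U's) + n·n (V's) + n²·n² (matrix gadgets)
size : ℕ → ℕ
size n = n * n + (n * n + (n * n) * (n * n))

decode : ∀ {n} → Fin (size n) → GV n
decode {n} x with splitAt (n * n) x
... | inj₁ y with remQuot {n} n y
...   | (i , k) = Un i k
decode {n} x | inj₂ z with splitAt (n * n) z
... | inj₁ y with remQuot {n} n y
...   | (j , k) = Vn j k
decode {n} x | inj₂ z | inj₂ w with remQuot {n * n} (n * n) w
... | (p , t) with remQuot {n} n p
...   | (i , j) = Mn i j t

-- All the data of one instance of the construction (all "arbitrary"
-- choices: gadgets, labelled endpoints, removed edges).
record Construction (d n : ℕ) (M : Fin n → Fin n → Bool) (u v : Fin n → Bool) : Set where
  field
    Ug Vg : Fin n → Adj n
    Ug-ok : ∀ i → IsGadgetBase d (Ug i)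
    Vg-ok : ∀ j → IsGadgetBase d (Vg j)
    -- matrix gadgets: K i j is a 6-edge-connected 2d-regular graph on n² nodes
    -- from which the edge {m0 i j , m1 i j} is removed;
    -- m0 i j = M_ij[0], m1 i j = M_ij[1]
    K     : Fin n → Fin n → Adj (n * n)
    K-ok  : ∀ i j → IsGadgetBase d (K i j)
    m0 m1 : Fin n → Fin n → Fin (n * n)
    m-edge : ∀ i j → K i j (m0 i j) (m1 i j) ≡ true
    -- for M_ij = 0: an edge {r0 i j , r1 i j} of the matrix gadget M_ij is removed
    r0 r1 : Fin n → Fin n → Fin (n * n)
    r-edge : ∀ i j → M i j ≡ false →
      removeEdge (K i j) (m0 i j) (m1 i j) (r0 i j) (r1 i j) ≡ true
    -- for u_i = 0: two edges {ua,ub}, {uc,ue} of U_i are removed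
    ua ub uc ue : Fin n → Fin n
    u-edge1 : ∀ i → u i ≡ false → Ug i (ua i) (ub i) ≡ true
    u-edge2 : ∀ i → u i ≡ false → removeEdge (Ug i) (ua i) (ub i) (uc i) (ue i) ≡ true
    -- for v_j = 0: two edges {va,vb}, {vc,ve} of V_j are removed
    va vb vc ve : Fin n → Fin n
    v-edge1 : ∀ j → v j ≡ false → Vg j (va j) (vb j) ≡ true
    v-edge2 : ∀ j → v j ≡ false → removeEdge (Vg j) (va j) (vb j) (vc j) (ve j) ≡ true

  U' : Fin n → Adj n
  U' i = if u i then Ug i else removeEdge (removeEdge (Ug i) (ua i) (ub i)) (uc i) (ue i)

  V' : Fin n → Adj n
  V' j = if v j then Vg j else removeEdge (removeEdge (Vg j) (va j) (vb j)) (vc j) (ve j)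

  Mg : Fin n → Fin n → Adj (n * n)
  Mg i j = if M i j then removeEdge (K i j) (m0 i j) (m1 i j)
           else removeEdge (removeEdge (K i j) (m0 i j) (m1 i j)) (r0 i j) (r1 i j)

  adjGV : GV n → GV n → Bool
  adjGV (Un i k) (Un i' k') = (i == i') ∧ U' i k k'
  adjGV (Vn j k) (Vn j' k') = (j == j') ∧ V' j k k'
  adjGV (Mn i j t) (Mn i' j' t') = (i == i') ∧ (j == j') ∧ Mg i j t t'
  adjGV (Un i k) (Mn i' j t) = (i == i') ∧ (k == j) ∧ (t == m0 i' j)
  adjGV (Mn i j t) (Un i' k) = (i == i') ∧ (k == j) ∧ (t == m0 i j)
  adjGV (Vn j k) (Mn i j' t) = (j == j') ∧ (k == i) ∧ (t == m1 i j')
  adjGV (Mn i j t) (Vn j' k) = (j == j') ∧ (k == i) ∧ (t == m1 i j)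
  adjGV (Un _ _) (Vn _ _) = false
  adjGV (Vn _ _) (Un _ _) = false

  graph : Adj (size n)
  graph x y = adjGV (decode x) (decode y)

-- Density of the densest subgraph  ρ = max_{∅≠S} |E(S)|/|S|,
-- compared with a rational p/q (q > 0), by unfolding the maximum over
-- the finitely many nonempty S and cross-multiplying:
--   ρ ≥ p/q  iff  some nonempty S has |E(S)|/|S| ≥ p/q
--   ρ < p/q  iff  every nonempty S has |E(S)|/|S| < p/q

DensityAtLeast : ∀ {k} → Adj k → ℕ → ℕ → Set
DensityAtLeast {k} G p q = ∃[ S ] (Nonempty {k} S × p * ∣ S ∣ ≤ q * edgesIn G S)

DensityBelow : ∀ {k} → Adj k → ℕ → ℕ → Set
DensityBelow {k} G p q = ∀ (S : Subset k) → Nonempty S → q * edgesIn G S < p * ∣ S ∣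

module Submission where

open import Defs
open import Data.Bool using (Bool; true; false; _∧_; _∨_; not; if_then_else_; T)
open import Data.Bool.Properties using (∧-zeroʳ; ∧-identityʳ; ∧-comm; ∧-conicalˡ; ∧-conicalʳ; ∨-comm)
open import Data.Empty using (⊥-elim)
open import Data.Fin using (Fin; zero; suc; toℕ; _↑ˡ_; _↑ʳ_; combine; remQuot; _≟_)
open import Data.Fin.Properties using (suc-injective; toℕ-injective; splitAt-↑ˡ; splitAt-↑ʳ; remQuot-combine)
open import Data.Fin.Subset using (Subset; ∣_∣; Nonempty)
open import Data.Product using (_×_; _,_; ∃; ∃₂; proj₁; proj₂; uncurry)
open import Data.List using (List; []; _∷_; _++_; length)
open import Data.List.Properties using (length-++)
open import Data.List.Membership.Propositional using (_∈_)
open import Data.List.Membership.Propositional.Properties using (∈-++⁺ˡ; ∈-++⁺ʳ)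
open import Data.List.Relation.Unary.Any using (here; there)
open import Data.Vec using (lookup; tabulate; []; _∷_)
open import Data.Vec.Properties using ([]=⇒lookup; lookup⇒[]=; lookup∘tabulate)
open import Data.Nat using (ℕ; zero; suc; _+_; _*_; _≤_; _<_; z≤n; s≤s; _<ᵇ_; _≤?_)
open import Data.Nat.Properties
  using (+-identityʳ; +-assoc; +-comm; *-identityʳ; *-zeroʳ; *-comm; *-assoc; *-distribˡ-+; *-distribʳ-+;
         ≤-trans; ≤-reflexive; ≤-antisym; ≤-pred; ≰⇒>; ≮⇒≥; <-asym; <ᵇ⇒<; <⇒<ᵇ; m≤m+n; m≤n+m; m<m+n; m≤n*m;
         +-mono-≤; +-monoˡ-≤; +-monoʳ-≤; *-monoʳ-≤; +-cancelˡ-≤; +-cancelʳ-≤; *-cancelˡ-≤; *-cancelˡ-<;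
         module ≤-Reasoning)
open import Data.Nat.Tactic.RingSolver using (solve-∀)
open import Function using (_∘_; const; id)
open import Relation.Binary.PropositionalEquality
open import Relation.Nullary using (¬_; yes; no)

-- Write 2|E(S)| as the sum, over all gadgets, of the arcs (ordered adjacent pairs) inside the part of S
-- in that gadget, plus twice the number of connecting edges with both ends in S.  A gadget is
-- 2d-regular, so its part T of S carries 2d·|T| arcs minus the arcs leaving T and minus the arcs of
-- the gadget's removed edges.  By 6-edge-connectivity a proper nonempty T is left by at least 6 arcs,
-- which pays for everything; so S exceeds the average degree 2d only at matrix gadgets taken whole.
-- Such an M_ij has lost 2 arcs (4 if M_ij = 0) against at most 4 arcs from its two connecting edges,
-- so it gains 2 arcs only if M_ij = 1 and U_i[j], V_j[i] ∈ S.  When uMv = 0 this forces u_i = 0 or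
-- v_j = 0, and that vector gadget, which meets S, has lost 4 arcs; the loss is shared by at most n
-- matrix gadgets of n² nodes each.  Balancing gives |E(S)|/|S| < d + 1/(n²+2n).
-- If u_i M_ij v_j = 1, the set U_i ∪ V_j ∪ M_ij has n²+2n nodes and d(n²+2n)+1 edges.

false≢true : false ≢ true
false≢true ()

⟦_⟧ : Bool → ℕ
⟦ true ⟧  = 1
⟦ false ⟧ = 0

⟦⟧≤1 : ∀ b → ⟦ b ⟧ ≤ 1
⟦⟧≤1 true  = s≤s z≤n
⟦⟧≤1 false = z≤n

⟦⟧-mono : ∀ {a b} → (a ≡ true → b ≡ true) → ⟦ a ⟧ ≤ ⟦ b ⟧
⟦⟧-mono {true}  a⇒b rewrite a⇒b refl = s≤s z≤n
⟦⟧-mono {false} _ = z≤n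

∧∧-zeroʳ : ∀ a b → a ∧ b ∧ false ≡ false
∧∧-zeroʳ a b = trans (cong (a ∧_) (∧-zeroʳ b)) (∧-zeroʳ a)

⟦∧∧false⟧ : ∀ a b → ⟦ a ∧ b ∧ false ⟧ ≡ 0
⟦∧∧false⟧ a b = cong ⟦_⟧ (∧∧-zeroʳ a b)

count≡sumF : ∀ {k} (f : Fin k → Bool) → count f ≡ sumF (⟦_⟧ ∘ f)
count≡sumF {zero}  f = refl
count≡sumF {suc k} f with f zero
... | true  = cong suc (count≡sumF (f ∘ suc))
... | false = count≡sumF (f ∘ suc)

count-cong : ∀ {k} {f g : Fin k → Bool} → (∀ x → f x ≡ g x) → count f ≡ count g
count-cong {zero}  f≗g = refl
count-cong {suc k} f≗g = cong₂ (λ b c → (if b then 1 else 0) + c) (f≗g zero) (count-cong (f≗g ∘ suc))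

-- Finite sums

sumF-cong : ∀ {k} {f g : Fin k → ℕ} → (∀ x → f x ≡ g x) → sumF f ≡ sumF g
sumF-cong {zero}  f≗g = refl
sumF-cong {suc k} f≗g = cong₂ _+_ (f≗g zero) (sumF-cong (f≗g ∘ suc))

sumF-mono : ∀ {k} {f g : Fin k → ℕ} → (∀ x → f x ≤ g x) → sumF f ≤ sumF g
sumF-mono {zero}  f≤g = z≤n
sumF-mono {suc k} f≤g = +-mono-≤ (f≤g zero) (sumF-mono (f≤g ∘ suc))

sumF-distrib-+ : ∀ {k} (f g : Fin k → ℕ) → sumF (λ x → f x + g x) ≡ sumF f + sumF g
sumF-distrib-+ {zero}  f g = refl
sumF-distrib-+ {suc k} f g =
  trans (cong (f zero + g zero +_) (sumF-distrib-+ (f ∘ suc) (g ∘ suc)))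
        (interchange (f zero) (g zero) (sumF (f ∘ suc)) (sumF (g ∘ suc)))
  where
  interchange : ∀ a b c d → (a + b) + (c + d) ≡ (a + c) + (b + d)
  interchange = solve-∀

sumF-const : ∀ {k} c → sumF {k} (λ _ → c) ≡ k * c
sumF-const {zero}  c = refl
sumF-const {suc k} c = cong (c +_) (sumF-const {k} c)

sumF-zero : ∀ {k} {f : Fin k → ℕ} → (∀ x → f x ≡ 0) → sumF f ≡ 0
sumF-zero {zero}  f≗0 = refl
sumF-zero {suc k} f≗0 = cong₂ _+_ (f≗0 zero) (sumF-zero (f≗0 ∘ suc))

*-distribˡ-sumF : ∀ {k} c (f : Fin k → ℕ) → c * sumF f ≡ sumF (λ x → c * f x)
*-distribˡ-sumF {zero}  c f = *-zeroʳ c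
*-distribˡ-sumF {suc k} c f =
  trans (*-distribˡ-+ c (f zero) _) (cong (c * f zero +_) (*-distribˡ-sumF c (f ∘ suc)))

sumF-comm : ∀ {k m} (f : Fin k → Fin m → ℕ) → sumF (λ x → sumF (f x)) ≡ sumF (λ y → sumF (λ x → f x y))
sumF-comm {zero}  {m} f = sym (sumF-zero {m} (λ _ → refl))
sumF-comm {suc k} f =
  trans (cong (sumF (f zero) +_) (sumF-comm (f ∘ suc)))
        (sym (sumF-distrib-+ (f zero) (λ y → sumF (λ x → f (suc x) y))))

sumF-↑ : ∀ m {n} (f : Fin (m + n) → ℕ) →
  sumF f ≡ sumF (λ i → f (i ↑ˡ n)) + sumF (λ j → f (m ↑ʳ j))
sumF-↑ zero    f = refl
sumF-↑ (suc m) f = trans (cong (f zero +_) (sumF-↑ m (f ∘ suc))) (sym (+-assoc (f zero) _ _))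

sumF-combine : ∀ m {n} (f : Fin (m * n) → ℕ) →
  sumF f ≡ sumF {m} (λ i → sumF {n} (λ j → f (combine i j)))
sumF-combine zero    f = refl
sumF-combine (suc m) {n} f =
  trans (sumF-↑ n f) (cong (sumF (λ j → f (j ↑ˡ (m * n))) +_) (sumF-combine m (λ x → f (n ↑ʳ x))))

sumF-single : ∀ {k} (a : Fin k) (f : Fin k → ℕ) → (∀ x → x ≢ a → f x ≡ 0) → sumF f ≡ f a
sumF-single zero f off =
  trans (cong (f zero +_) (sumF-zero (λ x → off (suc x) λ ()))) (+-identityʳ (f zero))
sumF-single (suc a) f off =
  cong₂ _+_ (off zero λ ()) (sumF-single a (f ∘ suc) (λ x x≢a → off (suc x) (x≢a ∘ suc-injective)))

≤-sumF : ∀ {k} (f : Fin k → ℕ) (a : Fin k) → f a ≤ sumF f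
≤-sumF f zero    = m≤m+n _ _
≤-sumF f (suc a) = ≤-trans (≤-sumF (f ∘ suc) a) (m≤n+m _ (f zero))

sumF² : ∀ {k m} → (Fin k → Fin m → ℕ) → ℕ
sumF² f = sumF λ x → sumF (f x)

sumF²-cong : ∀ {k m} {f g : Fin k → Fin m → ℕ} → (∀ x y → f x y ≡ g x y) → sumF² f ≡ sumF² g
sumF²-cong f≗g = sumF-cong (sumF-cong ∘ f≗g)

sumF²-mono : ∀ {k m} {f g : Fin k → Fin m → ℕ} → (∀ x y → f x y ≤ g x y) → sumF² f ≤ sumF² g
sumF²-mono f≤g = sumF-mono (sumF-mono ∘ f≤g)

sumF²-distrib-+ : ∀ {k m} (f g : Fin k → Fin m → ℕ) →
  sumF² (λ x y → f x y + g x y) ≡ sumF² f + sumF² g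
sumF²-distrib-+ f g =
  trans (sumF-cong (λ x → sumF-distrib-+ (f x) (g x))) (sumF-distrib-+ (sumF ∘ f) (sumF ∘ g))

*-distribˡ-sumF² : ∀ {k m} c (f : Fin k → Fin m → ℕ) → c * sumF² f ≡ sumF² (λ x y → c * f x y)
*-distribˡ-sumF² c f =
  trans (*-distribˡ-sumF c (sumF ∘ f)) (sumF-cong (λ x → *-distribˡ-sumF c (f x)))

≤-sumF² : ∀ {k m} (f : Fin k → Fin m → ℕ) a b → f a b ≤ sumF² f
≤-sumF² f a b = ≤-trans (≤-sumF (f a) b) (≤-sumF (sumF ∘ f) a)

sumF-mono-+* : ∀ {k} c (f g h : Fin k → ℕ) → (∀ i → f i + c * g i ≤ h i) → sumF f + c * sumF g ≤ sumF h
sumF-mono-+* c f g h pointwise = begin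
  sumF f + c * sumF g                ≡⟨ cong (sumF f +_) (*-distribˡ-sumF c g) ⟩
  sumF f + sumF (λ i → c * g i)      ≡⟨ sumF-distrib-+ f (λ i → c * g i) ⟨
  sumF (λ i → f i + c * g i)         ≤⟨ sumF-mono pointwise ⟩
  sumF h                             ∎
  where open ≤-Reasoning

sumF²-mono-+* : ∀ {k m} c (f g h : Fin k → Fin m → ℕ) → (∀ i j → f i j + c * g i j ≤ h i j) →
  sumF² f + c * sumF² g ≤ sumF² h
sumF²-mono-+* c f g h pointwise =
  sumF-mono-+* c (sumF ∘ f) (sumF ∘ g) (sumF ∘ h) (λ i → sumF-mono-+* c (f i) (g i) (h i) (pointwise i))

sumF²-separable : ∀ {k} (a b : Fin k → ℕ) → sumF² (λ i j → a i + b j) ≡ k * sumF a + k * sumF b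
sumF²-separable {k} a b =
  trans (sumF²-distrib-+ (λ i _ → a i) (λ _ j → b j))
        (cong₂ _+_ (trans (sumF-cong (λ i → sumF-const {k} (a i))) (sym (*-distribˡ-sumF k a)))
                   (sumF-const {k} (sumF b)))

count-const : ∀ {k} b → count {k} (λ _ → b) ≡ k * ⟦ b ⟧
count-const {k} b = trans (count≡sumF {k} (λ _ → b)) (sumF-const {k} ⟦ b ⟧)

count-all : ∀ {k} {T : Fin k → Bool} → (∀ x → T x ≡ true) → count T ≡ k
count-all {k} {T} all =
  trans (count≡sumF T) (trans (sumF-cong (cong ⟦_⟧ ∘ all)) (trans (sumF-const {k} 1) (*-identityʳ k)))

count≡∣∣ : ∀ {k} (S : Subset k) → count (lookup S) ≡ ∣ S ∣
count≡∣∣ []          = refl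
count≡∣∣ (true ∷ S)  = cong suc (count≡∣∣ S)
count≡∣∣ (false ∷ S) = count≡∣∣ S

==-refl : ∀ {k} (x : Fin k) → (x == x) ≡ true
==-refl x with x ≟ x
... | yes _   = refl
... | no x≢x = ⊥-elim (x≢x refl)

==-≢ : ∀ {k} {x y : Fin k} → x ≢ y → (x == y) ≡ false
==-≢ {x = x} {y} x≢y with x ≟ y
... | yes x≡y = ⊥-elim (x≢y x≡y)
... | no _    = refl

==⇒≡ : ∀ {k} {x y : Fin k} → (x == y) ≡ true → x ≡ y
==⇒≡ {x = x} {y} e with x ≟ y | e
... | yes x≡y | _ = x≡y
... | no _    | ()

==-sym : ∀ {k} (x y : Fin k) → (x == y) ≡ (y == x)
==-sym x y with x ≟ y
... | yes refl = sym (==-refl x)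
... | no x≢y   = sym (==-≢ (x≢y ∘ sym))

sumF-select : ∀ {k} (a : Fin k) (g : Fin k → Bool → ℕ) → (∀ x → g x false ≡ 0) →
  sumF (λ x → g x (x == a)) ≡ g a true
sumF-select a g g-false =
  trans (sumF-single a _ (λ x x≢a → trans (cong (g x) (==-≢ x≢a)) (g-false x)))
        (cong (g a) (==-refl a))

sumF-select′ : ∀ {k} (a : Fin k) (g : Fin k → Bool → ℕ) → (∀ x → g x false ≡ 0) →
  sumF (λ x → g x (a == x)) ≡ g a true
sumF-select′ a g g-false =
  trans (sumF-cong (λ x → cong (g x) (==-sym a x))) (sumF-select a g g-false)

anyF-witness : ∀ {k} (T : Fin k → Bool) → anyF T ≡ true → ∃ λ x → T x ≡ true
anyF-witness {suc k} T any with T zero in T0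
... | true  = zero , T0
... | false = let x , Tx = anyF-witness (T ∘ suc) any in suc x , Tx

anyF-intro : ∀ {k} (T : Fin k → Bool) x → T x ≡ true → anyF T ≡ true
anyF-intro T zero    Tx rewrite Tx = refl
anyF-intro T (suc x) Tx with T zero
... | true  = refl
... | false = anyF-intro (T ∘ suc) x Tx

anyF-false : ∀ {k} (T : Fin k → Bool) → anyF T ≡ false → ∀ x → T x ≡ false
anyF-false T none x with T x in Tx
... | false = refl
... | true  = ⊥-elim (false≢true (trans (sym none) (anyF-intro T x Tx)))

allF : ∀ {k} → (Fin k → Bool) → Bool
allF {zero}  T = true
allF {suc k} T = T zero ∧ allF (T ∘ suc)

allF-true : ∀ {k} {T : Fin k → Bool} → allF T ≡ true → ∀ x → T x ≡ true
allF-true {T = T} all zero    = ∧-conicalˡ (T zero) _ all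
allF-true {T = T} all (suc x) = allF-true (∧-conicalʳ (T zero) _ all) x

allF-false : ∀ {k} (T : Fin k → Bool) → allF T ≡ false → ∃ λ x → T x ≡ false
allF-false {suc k} T notAll with T zero in T0
... | false = zero , T0
... | true  = let x , Tx = allF-false (T ∘ suc) notAll in suc x , Tx

<ᵇ≡false⇒≮ : ∀ m n → (m <ᵇ n) ≡ false → ¬ m < n
<ᵇ≡false⇒≮ m n m≮ᵇn m<n = subst T m≮ᵇn (<⇒<ᵇ m<n)

-- Arcs and cuts

arcs : ∀ {k} → Adj k → (Fin k → Bool) → ℕ
arcs H T = sumF² λ x y → ⟦ T x ∧ T y ∧ H x y ⟧

forwardPairs : ∀ {k} → (Fin k → Fin k → Bool) → ℕ
forwardPairs h = sumF² λ x y → ⟦ (toℕ x <ᵇ toℕ y) ∧ h x y ⟧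

module _ {k} (h : Fin k → Fin k → Bool)
         (h-sym : ∀ x y → h x y ≡ h y x) (h-irrefl : ∀ x → h x x ≡ false) where

  ⟦⟧-split-< : ∀ x y → ⟦ h x y ⟧ ≡ ⟦ (toℕ x <ᵇ toℕ y) ∧ h x y ⟧ + ⟦ (toℕ y <ᵇ toℕ x) ∧ h y x ⟧
  ⟦⟧-split-< x y with toℕ x <ᵇ toℕ y in x<y | toℕ y <ᵇ toℕ x in y<x
  ... | true  | true  =
    ⊥-elim (<-asym (<ᵇ⇒< (toℕ x) (toℕ y) (subst T (sym x<y) _)) (<ᵇ⇒< (toℕ y) (toℕ x) (subst T (sym y<x) _)))
  ... | true  | false = sym (+-identityʳ _)
  ... | false | true  = cong ⟦_⟧ (h-sym x y)
  ... | false | false =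
    trans (cong (λ z → ⟦ h x z ⟧) (sym x≡y)) (cong ⟦_⟧ (h-irrefl x))
    where
    x≡y : x ≡ y
    x≡y = toℕ-injective
      (≤-antisym (≮⇒≥ (<ᵇ≡false⇒≮ (toℕ y) (toℕ x) y<x)) (≮⇒≥ (<ᵇ≡false⇒≮ (toℕ x) (toℕ y) x<y)))

  sumF²-symmetric : sumF² (λ x y → ⟦ h x y ⟧) ≡ forwardPairs h + forwardPairs h
  sumF²-symmetric = begin
    sumF² (λ x y → ⟦ h x y ⟧)
      ≡⟨ sumF-cong (λ x → trans (sumF-cong (⟦⟧-split-< x)) (sumF-distrib-+ (fwd x) (bwd x))) ⟩
    sumF (λ x → sumF (fwd x) + sumF (bwd x))
      ≡⟨ sumF-distrib-+ (λ x → sumF (fwd x)) (λ x → sumF (bwd x)) ⟩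
    forwardPairs h + sumF (λ x → sumF (bwd x))
      ≡⟨ cong (forwardPairs h +_) (sumF-comm bwd) ⟩
    forwardPairs h + forwardPairs h ∎
    where
    open ≡-Reasoning
    fwd bwd : Fin k → Fin k → ℕ
    fwd x y = ⟦ (toℕ x <ᵇ toℕ y) ∧ h x y ⟧
    bwd x y = ⟦ (toℕ y <ᵇ toℕ x) ∧ h y x ⟧

edgesIn-handshake : ∀ {k} (G : Adj k) (S : Subset k) → IsSimple G →
  edgesIn G S + edgesIn G S ≡ arcs G (lookup S)
edgesIn-handshake {k} G S (G-sym , G-irrefl) =
  sym (trans (sumF²-symmetric h h-sym h-irrefl) (cong₂ _+_ forward≡edges forward≡edges))
  where
  s : Fin k → Bool
  s = lookup S
  h : Fin k → Fin k → Bool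
  h x y = s x ∧ s y ∧ G x y
  h-sym : ∀ x y → h x y ≡ h y x
  h-sym x y rewrite G-sym x y with s x | s y
  ... | true  | true  = refl
  ... | true  | false = refl
  ... | false | true  = refl
  ... | false | false = refl
  h-irrefl : ∀ x → h x x ≡ false
  h-irrefl x rewrite G-irrefl x = ∧∧-zeroʳ (s x) (s x)
  forward≡edges : forwardPairs h ≡ edgesIn G S
  forward≡edges = sumF-cong (λ x → sym (count≡sumF (λ y → (toℕ x <ᵇ toℕ y) ∧ h x y)))

_⊆ᴱ_ : ∀ {k} → Adj k → Adj k → Set
H ⊆ᴱ B = ∀ x y → H x y ≡ true → B x y ≡ true

removeEdge-⊆ᴱ : ∀ {k} (H : Adj k) a b → removeEdge H a b ⊆ᴱ H
removeEdge-⊆ᴱ H a b x y = ∧-conicalˡ (H x y) _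

removeEdges-⊆ᴱ : ∀ {k} (H : Adj k) es → removeEdges H es ⊆ᴱ H
removeEdges-⊆ᴱ H []             x y e = e
removeEdges-⊆ᴱ H ((a , b) ∷ es) x y e = removeEdges-⊆ᴱ H es x y (removeEdge-⊆ᴱ (removeEdges H es) a b x y e)

removeEdges-∉ : ∀ {k} (H : Adj k) es {x y} → (x , y) ∈ es → removeEdges H es x y ≡ false
removeEdges-∉ H ((a , b) ∷ es) {x} {y} (here refl) rewrite ==-refl x | ==-refl y =
  ∧-zeroʳ (removeEdges H es x y)
removeEdges-∉ H ((a , b) ∷ es) {x} {y} (there xy∈es) rewrite removeEdges-∉ H es xy∈es = refl

if-⊆ᴱ : ∀ {k} b {A B H : Adj k} → A ⊆ᴱ H → B ⊆ᴱ H → (if b then A else B) ⊆ᴱ H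
if-⊆ᴱ true  A⊆H _ = A⊆H
if-⊆ᴱ false _ B⊆H = B⊆H

removeEdge₂-⊆ᴱ : ∀ {k} (H : Adj k) a b c e → removeEdge (removeEdge H a b) c e ⊆ᴱ H
removeEdge₂-⊆ᴱ H a b c e x y = removeEdge-⊆ᴱ H a b x y ∘ removeEdge-⊆ᴱ (removeEdge H a b) c e x y

select : ∀ {m} {B : Set} → (Fin m → Bool) → (Fin m → B) → List B
select {zero}  q f = []
select {suc m} q f = (if q zero then f zero ∷ [] else []) ++ select (q ∘ suc) (f ∘ suc)

length-select : ∀ {m} {B : Set} (q : Fin m → Bool) (f : Fin m → B) → length (select q f) ≡ count q
length-select {zero}  q f = refl
length-select {suc m} q f with q zero
... | true  = cong suc (length-select (q ∘ suc) (f ∘ suc))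
... | false = length-select (q ∘ suc) (f ∘ suc)

∈-select : ∀ {m} {B : Set} (q : Fin m → Bool) (f : Fin m → B) y → q y ≡ true → f y ∈ select q f
∈-select q f zero    qy rewrite qy = here refl
∈-select q f (suc y) qy = ∈-++⁺ʳ (if q zero then f zero ∷ [] else []) (∈-select (q ∘ suc) (f ∘ suc) y qy)

concatF : ∀ {k} {B : Set} → (Fin k → List B) → List B
concatF {zero}  F = []
concatF {suc k} F = F zero ++ concatF (F ∘ suc)

length-concatF : ∀ {k} {B : Set} (F : Fin k → List B) → length (concatF F) ≡ sumF (length ∘ F)
length-concatF {zero}  F = refl
length-concatF {suc k} F = trans (length-++ (F zero)) (cong (length (F zero) +_) (length-concatF (F ∘ suc)))

∈-concatF : ∀ {k} {B : Set} (F : Fin k → List B) x {b} → b ∈ F x → b ∈ concatF F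
∈-concatF F zero    b∈ = ∈-++⁺ˡ b∈
∈-concatF F (suc x) b∈ = ∈-++⁺ʳ (F zero) (∈-concatF (F ∘ suc) x b∈)

Reach-crossing : ∀ {k} {R : Adj k} (T : Fin k → Bool) {a b} → Reach R a b → T a ≡ true → T b ≡ false →
  ∃₂ λ x y → R x y ≡ true × T x ≡ true × T y ≡ false
Reach-crossing T here Ta Tb = ⊥-elim (false≢true (trans (sym Tb) Ta))
Reach-crossing T (step {y = y} Rxy walk) Ta Tb with T y in Ty
... | true  = Reach-crossing T walk Ty Tb
... | false = _ , y , Rxy , Ta , Ty

crosses : ∀ {k} → Adj k → (Fin k → Bool) → Fin k → Fin k → Bool
crosses H T x y = T x ∧ not (T y) ∧ H x y

cutArcs : ∀ {k} → Adj k → (Fin k → Bool) → ℕ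
cutArcs H T = sumF² λ x y → ⟦ crosses H T x y ⟧

cutList : ∀ {k} → Adj k → (Fin k → Bool) → List (Fin k × Fin k)
cutList H T = concatF λ x → select (crosses H T x) (x ,_)

length-cutList : ∀ {k} (H : Adj k) T → length (cutList H T) ≡ cutArcs H T
length-cutList H T = trans (length-concatF (λ x → select (crosses H T x) (x ,_))) (sumF-cong λ x →
  trans (length-select (crosses H T x) (x ,_)) (count≡sumF (crosses H T x)))

∈-cutList : ∀ {k} (H : Adj k) T {x y} → T x ≡ true → T y ≡ false → H x y ≡ true → (x , y) ∈ cutList H T
∈-cutList H T {x} {y} Tx Ty Hxy = ∈-concatF _ x (∈-select _ (x ,_) y is-cut)
  where
  is-cut : crosses H T x y ≡ true
  is-cut rewrite Tx | Ty = Hxy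

-- Otherwise deleting the at most five cut arcs leaves a walk from a to b, which must cross the cut.
cutArcs≥6 : ∀ {k} (H : Adj k) (T : Fin k → Bool) → SixEdgeConnected H →
  ∀ {a b} → T a ≡ true → T b ≡ false → 6 ≤ cutArcs H T
cutArcs≥6 H T H-6ec {a} {b} Ta Tb with 6 ≤? cutArcs H T
... | yes 6≤cut = 6≤cut
... | no  6≰cut with Reach-crossing T (H-6ec (cutList H T) short a b) Ta Tb
  where
  short : length (cutList H T) ≤ 5
  short = ≤-trans (≤-reflexive (length-cutList H T)) (≤-pred (≰⇒> 6≰cut))
...   | x , y , H∖cut-xy , Tx , Ty = ⊥-elim (false≢true (trans (sym gone) H∖cut-xy))
  where
  gone : removeEdges H (cutList H T) x y ≡ false
  gone = removeEdges-∉ H (cutList H T) (∈-cutList H T Tx Ty (removeEdges-⊆ᴱ H (cutList H T) x y H∖cut-xy))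

arcs+cutArcs : ∀ {k} (H : Adj k) r → Regular r H → ∀ T → arcs H T + cutArcs H T ≡ r * count T
arcs+cutArcs {k} H r H-reg T = begin
  arcs H T + cutArcs H T                                         ≡⟨ sumF²-distrib-+ inside crossing ⟨
  sumF² (λ x y → inside x y + crossing x y)                      ≡⟨ sumF-cong row ⟩
  sumF (λ x → r * ⟦ T x ⟧)                                       ≡⟨ *-distribˡ-sumF r (⟦_⟧ ∘ T) ⟨
  r * sumF (⟦_⟧ ∘ T)                                             ≡⟨ cong (r *_) (count≡sumF T) ⟨
  r * count T                                                    ∎
  where
  open ≡-Reasoning
  inside crossing : Fin k → Fin k → ℕ
  inside x y = ⟦ T x ∧ T y ∧ H x y ⟧
  crossing x y = ⟦ crosses H T x y ⟧
  split : ∀ b h → ⟦ b ∧ h ⟧ + ⟦ not b ∧ h ⟧ ≡ ⟦ h ⟧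
  split true  h = +-identityʳ ⟦ h ⟧
  split false h = refl
  row : ∀ x → sumF (λ y → inside x y + crossing x y) ≡ r * ⟦ T x ⟧
  row x with T x
  ... | true  = trans (sumF-cong (λ y → split (T y) (H x y)))
                  (trans (sym (count≡sumF (H x))) (trans (H-reg x) (sym (*-identityʳ r))))
  ... | false = trans (sumF-zero {k} (λ _ → refl)) (sym (*-zeroʳ r))

arcs-mono : ∀ {k} {H B : Adj k} → H ⊆ᴱ B → ∀ T → arcs H T ≤ arcs B T
arcs-mono {H = H} {B} H⊆B T = sumF²-mono pointwise
  where
  pointwise : ∀ x y → ⟦ T x ∧ T y ∧ H x y ⟧ ≤ ⟦ T x ∧ T y ∧ B x y ⟧
  pointwise x y with T x | T y
  ... | true  | true  = ⟦⟧-mono (H⊆B x y)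
  ... | true  | false = z≤n
  ... | false | _     = z≤n

module _ {k} {r} {B : Adj k} (B-reg : Regular r B) {H : Adj k} (H⊆B : H ⊆ᴱ B) (T : Fin k → Bool) where

  arcs≤ : arcs H T ≤ r * count T
  arcs≤ = ≤-trans (arcs-mono H⊆B T) (≤-trans (m≤m+n _ _) (≤-reflexive (arcs+cutArcs B r B-reg T)))

  arcs+6≤ : SixEdgeConnected B → ∀ {a b} → T a ≡ true → T b ≡ false → arcs H T + 6 ≤ r * count T
  arcs+6≤ B-6ec Ta Tb = ≤-trans (+-mono-≤ (arcs-mono H⊆B T) (cutArcs≥6 B T B-6ec Ta Tb))
                                (≤-reflexive (arcs+cutArcs B r B-reg T))

arcs-regular : ∀ {k} {r} {H : Adj k} → Regular r H → ∀ {T} → (∀ x → T x ≡ true) → arcs H T ≡ r * count T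
arcs-regular {k} {r} {H} H-reg {T} all =
  trans (sym (+-identityʳ _)) (trans (cong (arcs H T +_) (sym no-cut)) (arcs+cutArcs H r H-reg T))
  where
  no-cut : cutArcs H T ≡ 0
  no-cut = sumF-zero λ x → sumF-zero λ y →
    trans (cong (λ b → ⟦ T x ∧ not b ∧ H x y ⟧) (all y)) (cong ⟦_⟧ (∧-zeroʳ (T x)))

arcs-all : ∀ {k} (H : Adj k) {T} → (∀ x → T x ≡ true) → arcs H T ≡ arcs H (const true)
arcs-all H all = sumF²-cong λ x y → cong₂ (λ a b → ⟦ a ∧ b ∧ H x y ⟧) (all x) (all y)

removeEdge-simple : ∀ {k} (H : Adj k) a b → IsSimple H → IsSimple (removeEdge H a b)
removeEdge-simple H a b (H-sym , H-irrefl) = sym′ , irrefl′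
  where
  sym′ : ∀ x y → removeEdge H a b x y ≡ removeEdge H a b y x
  sym′ x y = cong₂ (λ h e → h ∧ not e) (H-sym x y)
    (trans (∨-comm (x == a ∧ y == b) _) (cong₂ _∨_ (∧-comm (x == b) (y == a)) (∧-comm (x == a) (y == b))))
  irrefl′ : ∀ x → removeEdge H a b x x ≡ false
  irrefl′ x rewrite H-irrefl x = refl

⟦⟧-removal : ∀ h p q → (p ≡ true → h ≡ true) → (q ≡ true → h ≡ true) → p ∧ q ≢ true →
  ⟦ h ⟧ ≡ ⟦ h ∧ not (p ∨ q) ⟧ + ⟦ p ⟧ + ⟦ q ⟧
⟦⟧-removal true  true  true  _   _   p∧q≢ = ⊥-elim (p∧q≢ refl)
⟦⟧-removal true  true  false _   _   _    = refl
⟦⟧-removal true  false true  _   _   _    = refl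
⟦⟧-removal true  false false _   _   _    = refl
⟦⟧-removal false true  _     p⇒h _   _    = ⊥-elim (false≢true (p⇒h refl))
⟦⟧-removal false false true  _   q⇒h _    = ⊥-elim (false≢true (q⇒h refl))
⟦⟧-removal false false false _   _   _    = refl

sumF²-indicator : ∀ {k m} (a : Fin k) (b : Fin m) → sumF² (λ x y → ⟦ (x == a) ∧ (y == b) ⟧) ≡ 1
sumF²-indicator {m = m} a b =
  trans (sumF-select a (λ _ c → sumF (λ y → ⟦ c ∧ (y == b) ⟧)) (λ _ → sumF-zero {m} (λ _ → refl)))
        (sumF-select b (λ _ c → ⟦ c ⟧) (λ _ → refl))

arcs-removeEdge : ∀ {k} (H : Adj k) a b → IsSimple H → H a b ≡ true →
  arcs H (const true) ≡ 2 + arcs (removeEdge H a b) (const true)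
arcs-removeEdge {k} H a b (H-sym , H-irrefl) Hab = begin
  sumF² (λ x y → ⟦ H x y ⟧)                                       ≡⟨ sumF²-cong split ⟩
  sumF² (λ x y → ⟦ H′ x y ⟧ + ⟦ at a b x y ⟧ + ⟦ at b a x y ⟧)      ≡⟨ sumF²-distrib-+ _ (λ x y → ⟦ at b a x y ⟧) ⟩
  sumF² (λ x y → ⟦ H′ x y ⟧ + ⟦ at a b x y ⟧) + sumF² (λ x y → ⟦ at b a x y ⟧)
    ≡⟨ cong (_+ sumF² (λ x y → ⟦ at b a x y ⟧)) (sumF²-distrib-+ _ (λ x y → ⟦ at a b x y ⟧)) ⟩
  arcs H′ (const true) + sumF² (λ x y → ⟦ at a b x y ⟧) + sumF² (λ x y → ⟦ at b a x y ⟧)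
    ≡⟨ cong₂ (λ u v → arcs H′ (const true) + u + v) (sumF²-indicator a b) (sumF²-indicator b a) ⟩
  arcs H′ (const true) + 1 + 1                                     ≡⟨ +1+1 (arcs H′ (const true)) ⟩
  2 + arcs H′ (const true)                                         ∎
  where
  open ≡-Reasoning
  +1+1 : ∀ a → a + 1 + 1 ≡ 2 + a
  +1+1 = solve-∀
  H′ : Adj k
  H′ = removeEdge H a b
  at : Fin k → Fin k → Fin k → Fin k → Bool
  at u v x y = (x == u) ∧ (y == v)
  at⇒≡ : ∀ u v x y → at u v x y ≡ true → x ≡ u × y ≡ v
  at⇒≡ u v x y e = ==⇒≡ (∧-conicalˡ (x == u) (y == v) e) , ==⇒≡ (∧-conicalʳ (x == u) (y == v) e)
  split : ∀ x y → ⟦ H x y ⟧ ≡ ⟦ H′ x y ⟧ + ⟦ at a b x y ⟧ + ⟦ at b a x y ⟧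
  split x y = ⟦⟧-removal (H x y) (at a b x y) (at b a x y) at-ab at-ba both
    where
    at-ab : at a b x y ≡ true → H x y ≡ true
    at-ab e with at⇒≡ a b x y e
    ... | refl , refl = Hab
    at-ba : at b a x y ≡ true → H x y ≡ true
    at-ba e with at⇒≡ b a x y e
    ... | refl , refl = trans (H-sym b a) Hab
    both : at a b x y ∧ at b a x y ≢ true
    both e with at⇒≡ a b x y (∧-conicalˡ (at a b x y) _ e) | at⇒≡ b a x y (∧-conicalʳ (at a b x y) _ e)
    ... | refl , refl | refl , _ = false≢true (trans (sym (H-irrefl x)) Hab)

arcs-removeEdge₂ : ∀ {k} (H : Adj k) a b c e → IsSimple H → H a b ≡ true → removeEdge H a b c e ≡ true →
  arcs H (const true) ≡ 4 + arcs (removeEdge (removeEdge H a b) c e) (const true)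
arcs-removeEdge₂ H a b c e H-simple Hab H′ce =
  trans (arcs-removeEdge H a b H-simple Hab)
        (cong (2 +_) (arcs-removeEdge (removeEdge H a b) c e (removeEdge-simple H a b H-simple) H′ce))

-- Gadgets

vectorGadget : ∀ {k} → Adj k → Bool → Fin k → Fin k → Fin k → Fin k → Adj k
vectorGadget B b a₁ a₂ c₁ c₂ = if b then B else removeEdge (removeEdge B a₁ a₂) c₁ c₂

matrixGadget : ∀ {k} → Adj k → Fin k → Fin k → Bool → Fin k → Fin k → Adj k
matrixGadget B m₀ m₁ b r₀ r₁ = if b then removeEdge B m₀ m₁ else removeEdge (removeEdge B m₀ m₁) r₀ r₁

module _ {d k} {B : Adj k} (B-gadget : IsGadgetBase d B) where

  private
    B-simple : IsSimple B
    B-simple = proj₁ B-gadget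
    B-regular : Regular (2 * d) B
    B-regular = proj₁ (proj₂ B-gadget)
    B-6ec : SixEdgeConnected B
    B-6ec = proj₂ (proj₂ B-gadget)

    full-arcs : ∀ {T} → (∀ x → T x ≡ true) → arcs B (const true) ≡ 2 * d * count T
    full-arcs all = trans (sym (arcs-all B all)) (arcs-regular B-regular all)

  -- Selected whole, a deficient vector gadget has lost 4 arcs; a proper part has at least 6 cut arcs.
  vector-gadget-bound : ∀ (b : Bool) (a₁ a₂ c₁ c₂ : Fin k) →
    (b ≡ false → B a₁ a₂ ≡ true) → (b ≡ false → removeEdge B a₁ a₂ c₁ c₂ ≡ true) → ∀ T →
    arcs (vectorGadget B b a₁ a₂ c₁ c₂) T + 4 * ⟦ anyF T ∧ not b ⟧ ≤ 2 * d * count T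
  vector-gadget-bound b a₁ a₂ c₁ c₂ edge₁ edge₂ T with anyF T in any | b
  ... | false | b′ = ≤-trans (≤-reflexive (+-identityʳ _))
    (arcs≤ B-regular (if-⊆ᴱ b′ (λ _ _ → id) (removeEdge₂-⊆ᴱ B a₁ a₂ c₁ c₂)) T)
  ... | true  | true  = ≤-trans (≤-reflexive (+-identityʳ _)) (arcs≤ B-regular (λ _ _ → id) T)
  ... | true  | false with allF T in all
  ...   | true  = ≤-reflexive (begin
    arcs H T + 4                  ≡⟨ cong (_+ 4) (arcs-all H (allF-true all)) ⟩
    arcs H (const true) + 4       ≡⟨ +-comm _ 4 ⟩
    4 + arcs H (const true)       ≡⟨ arcs-removeEdge₂ B a₁ a₂ c₁ c₂ B-simple (edge₁ refl) (edge₂ refl) ⟨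
    arcs B (const true)           ≡⟨ full-arcs (allF-true all) ⟩
    2 * d * count T               ∎)
    where
    open ≡-Reasoning
    H : Adj k
    H = removeEdge (removeEdge B a₁ a₂) c₁ c₂
  ...   | false = ≤-trans (+-monoʳ-≤ _ (m≤m+n 4 2))
    (arcs+6≤ B-regular (removeEdge₂-⊆ᴱ B a₁ a₂ c₁ c₂) T B-6ec
      (proj₂ (anyF-witness T any)) (proj₂ (allF-false T all)))

  private
    H⊆B : ∀ m₀ m₁ b r₀ r₁ → matrixGadget B m₀ m₁ b r₀ r₁ ⊆ᴱ B
    H⊆B m₀ m₁ b r₀ r₁ = if-⊆ᴱ b (removeEdge-⊆ᴱ B m₀ m₁) (removeEdge₂-⊆ᴱ B m₀ m₁ r₀ r₁)

    ⟦⟧+⟦⟧≤2 : ∀ x y → ⟦ x ⟧ + ⟦ y ⟧ ≤ 2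
    ⟦⟧+⟦⟧≤2 x y = +-mono-≤ (⟦⟧≤1 x) (⟦⟧≤1 y)

    links≤ : ∀ p x q y → ⟦ p ∧ x ⟧ + ⟦ q ∧ y ⟧ ≤ 1 + ⟦ p ∧ q ⟧
    links≤ true  x true  y = ⟦⟧+⟦⟧≤2 x y
    links≤ true  x false y = ≤-trans (≤-reflexive (+-identityʳ ⟦ x ⟧)) (⟦⟧≤1 x)
    links≤ false x q     y = ⟦⟧≤1 (q ∧ y)

    matrix-full : ∀ m₀ m₁ → B m₀ m₁ ≡ true → ∀ b r₀ r₁ → (b ≡ false → removeEdge B m₀ m₁ r₀ r₁ ≡ true) →
      ∀ {T} → (∀ x → T x ≡ true) → ∀ pU x pV y →
      arcs (matrixGadget B m₀ m₁ b r₀ r₁) T + 2 * (⟦ pU ∧ x ⟧ + ⟦ pV ∧ y ⟧)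
        ≤ 2 * d * count T + 2 * ⟦ b ∧ pU ∧ pV ⟧
    matrix-full m₀ m₁ edge true r₀ r₁ _ {T} all pU x pV y = begin
      arcs H T + 2 * (⟦ pU ∧ x ⟧ + ⟦ pV ∧ y ⟧)   ≤⟨ +-monoʳ-≤ (arcs H T) (*-monoʳ-≤ 2 (links≤ pU x pV y)) ⟩
      arcs H T + 2 * (1 + ⟦ pU ∧ pV ⟧)           ≡⟨ shift (arcs H T) ⟦ pU ∧ pV ⟧ ⟩
      (2 + arcs H T) + 2 * ⟦ pU ∧ pV ⟧           ≡⟨ cong (_+ 2 * ⟦ pU ∧ pV ⟧) (cong (2 +_) (arcs-all H all)) ⟩
      (2 + arcs H (const true)) + 2 * ⟦ pU ∧ pV ⟧ ≡⟨ cong (_+ 2 * ⟦ pU ∧ pV ⟧) (arcs-removeEdge B m₀ m₁ B-simple edge) ⟨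
      arcs B (const true) + 2 * ⟦ pU ∧ pV ⟧      ≡⟨ cong (_+ 2 * ⟦ pU ∧ pV ⟧) (full-arcs all) ⟩
      2 * d * count T + 2 * ⟦ pU ∧ pV ⟧          ∎
      where
      open ≤-Reasoning
      H : Adj k
      H = removeEdge B m₀ m₁
      shift : ∀ a g → a + 2 * (1 + g) ≡ (2 + a) + 2 * g
      shift = solve-∀
    matrix-full m₀ m₁ edge false r₀ r₁ edge′ {T} all pU x pV y = begin
      arcs H T + 2 * (⟦ pU ∧ x ⟧ + ⟦ pV ∧ y ⟧)   ≤⟨ +-monoʳ-≤ (arcs H T) (*-monoʳ-≤ 2 (⟦⟧+⟦⟧≤2 (pU ∧ x) (pV ∧ y))) ⟩
      arcs H T + 4                                ≡⟨ +-comm (arcs H T) 4 ⟩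
      4 + arcs H T                                ≡⟨ cong (4 +_) (arcs-all H all) ⟩
      4 + arcs H (const true)                     ≡⟨ arcs-removeEdge₂ B m₀ m₁ r₀ r₁ B-simple edge (edge′ refl) ⟨
      arcs B (const true)                         ≡⟨ full-arcs all ⟩
      2 * d * count T                             ≡⟨ +-identityʳ _ ⟨
      2 * d * count T + 0                         ∎
      where
      open ≤-Reasoning
      H : Adj k
      H = removeEdge (removeEdge B m₀ m₁) r₀ r₁

    matrix-proper : ∀ {H} → H ⊆ᴱ B → ∀ {T a c} → T a ≡ true → T c ≡ false → ∀ x y e →
      arcs H T + 2 * (⟦ x ⟧ + ⟦ y ⟧) ≤ 2 * d * count T + e
    matrix-proper H⊆B {T} Ta Tc x y e =
      ≤-trans (+-monoʳ-≤ _ (≤-trans (*-monoʳ-≤ 2 (⟦⟧+⟦⟧≤2 x y)) (m≤m+n 4 2)))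
              (≤-trans (arcs+6≤ B-regular H⊆B T B-6ec Ta Tc) (m≤m+n _ e))

  -- The two links are paid for by the cut or by a removed edge, except when the gadget is selected
  -- whole, M_ij = 1 and both linked vector nodes are selected.
  matrix-gadget-bound : ∀ (m₀ m₁ : Fin k) → B m₀ m₁ ≡ true → ∀ (b : Bool) (r₀ r₁ : Fin k) →
    (b ≡ false → removeEdge B m₀ m₁ r₀ r₁ ≡ true) → ∀ T (pU pV : Bool) →
    arcs (matrixGadget B m₀ m₁ b r₀ r₁) T + 2 * (⟦ pU ∧ T m₀ ⟧ + ⟦ pV ∧ T m₁ ⟧)
      ≤ 2 * d * count T + 2 * ⟦ allF T ∧ b ∧ pU ∧ pV ⟧
  matrix-gadget-bound m₀ m₁ edge b r₀ r₁ edge′ T pU pV with allF T in all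
  ... | true  = matrix-full m₀ m₁ edge b r₀ r₁ edge′ (allF-true all) pU (T m₀) pV (T m₁)
  ... | false with T m₀ in T₀ | T m₁ in T₁
  ...   | true  | t₁    = matrix-proper (H⊆B m₀ m₁ b r₀ r₁) T₀ (proj₂ (allF-false T all)) (pU ∧ true) (pV ∧ t₁) 0
  ...   | false | true  = matrix-proper (H⊆B m₀ m₁ b r₀ r₁) T₁ (proj₂ (allF-false T all)) (pU ∧ false) (pV ∧ true) 0
  ...   | false | false rewrite ∧-zeroʳ pU | ∧-zeroʳ pV =
    +-monoˡ-≤ 0 (arcs≤ B-regular (H⊆B m₀ m₁ b r₀ r₁) T)

-- The graph G

module _ {n : ℕ} where

  encode : GV n → Fin (size n)
  encode (Un i k)   = combine i k ↑ˡ (n * n + (n * n) * (n * n))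
  encode (Vn j k)   = (n * n) ↑ʳ (combine j k ↑ˡ ((n * n) * (n * n)))
  encode (Mn i j t) = (n * n) ↑ʳ ((n * n) ↑ʳ combine (combine i j) t)

  decode-encode : ∀ a → decode (encode a) ≡ a
  decode-encode (Un i k)
    rewrite splitAt-↑ˡ (n * n) (combine i k) (n * n + (n * n) * (n * n)) =
    cong (uncurry Un) (remQuot-combine {n} {n} i k)
  decode-encode (Vn j k)
    rewrite splitAt-↑ʳ (n * n) (n * n + (n * n) * (n * n)) (combine j k ↑ˡ ((n * n) * (n * n)))
          | splitAt-↑ˡ (n * n) (combine j k) ((n * n) * (n * n)) =
    cong (uncurry Vn) (remQuot-combine {n} {n} j k)
  decode-encode (Mn i j t)
    rewrite splitAt-↑ʳ (n * n) (n * n + (n * n) * (n * n)) ((n * n) ↑ʳ combine (combine i j) t)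
          | splitAt-↑ʳ (n * n) ((n * n) * (n * n)) (combine (combine i j) t) =
    trans (cong (λ p → uncurry Mn (remQuot {n} n (proj₁ p)) (proj₂ p)) (remQuot-combine {n * n} {n * n} (combine i j) t))
          (cong (λ p → uncurry Mn p t) (remQuot-combine {n} {n} i j))

  sumGV : (GV n → ℕ) → ℕ
  sumGV g = sumF² (λ i k → g (Un i k)) + (sumF² (λ j k → g (Vn j k)) + sumF² (λ i j → sumF (g ∘ Mn i j)))

  sumF-encode : (f : Fin (size n) → ℕ) → sumF f ≡ sumGV (f ∘ encode)
  sumF-encode f =
    trans (sumF-↑ (n * n) f) (cong₂ _+_ (sumF-combine n (λ x → f (x ↑ˡ _)))
      (trans (sumF-↑ (n * n) (λ z → f ((n * n) ↑ʳ z))) (cong₂ _+_ (sumF-combine n (λ y → f ((n * n) ↑ʳ (y ↑ˡ _))))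
        (trans (sumF-combine (n * n) (λ w → f ((n * n) ↑ʳ ((n * n) ↑ʳ w))))
               (sumF-combine n (λ p → sumF (λ t → f ((n * n) ↑ʳ ((n * n) ↑ʳ combine p t)))))))))

  sumGV-cong : {g h : GV n → ℕ} → (∀ a → g a ≡ h a) → sumGV g ≡ sumGV h
  sumGV-cong g≗h = cong₂ _+_ (sumF²-cong (λ i k → g≗h (Un i k)))
    (cong₂ _+_ (sumF²-cong (λ j k → g≗h (Vn j k))) (sumF²-cong (λ i j → sumF-cong (g≗h ∘ Mn i j))))

module Decomposition {d n M u v} (C : Construction d n M u v) (s : Fin (size n) → Bool) where
  open Construction C

  sU sV : Fin n → Fin n → Bool
  sU i k = s (encode (Un i k))
  sV j k = s (encode (Vn j k))

  sM : Fin n → Fin n → Fin (n * n) → Bool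
  sM i j t = s (encode (Mn i j t))

  -- arcs from a node a, itself selected iff b, to the selected nodes of the U-, V- and M-gadgets
  toU toV toM : GV n → Bool → ℕ
  toU a b = sumF² λ i k → ⟦ b ∧ sU i k ∧ adjGV a (Un i k) ⟧
  toV a b = sumF² λ j k → ⟦ b ∧ sV j k ∧ adjGV a (Vn j k) ⟧
  toM a b = sumF² λ i j → sumF λ t → ⟦ b ∧ sM i j t ∧ adjGV a (Mn i j t) ⟧

  arcs-graph-split : arcs graph s ≡ sumGV (λ a → toU a (s (encode a)) + (toV a (s (encode a)) + toM a (s (encode a))))
  arcs-graph-split =
    trans (sumF-encode {n} (λ x → sumF λ y → ⟦ s x ∧ s y ∧ graph x y ⟧)) (sumGV-cong λ a →
      trans (sumF-encode {n} (λ y → ⟦ s (encode a) ∧ s y ∧ adjGV (decode (encode a)) (decode y) ⟧)) (sumGV-cong λ c →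
        cong₂ (λ a′ c′ → ⟦ s (encode a) ∧ s (encode c) ∧ adjGV a′ c′ ⟧) (decode-encode a) (decode-encode c)))

  private
    vanish : ∀ b x c → ⟦ b ∧ x ∧ (c ∧ false) ⟧ ≡ 0
    vanish b x c = trans (cong (λ z → ⟦ b ∧ x ∧ z ⟧) (∧-zeroʳ c)) (⟦∧∧false⟧ b x)

    vanish₂ : ∀ {k m} (f : Fin k → Fin m → Bool) b → sumF² (λ x y → ⟦ b ∧ f x y ∧ false ⟧) ≡ 0
    vanish₂ {m = m} f b = sumF-zero λ x → sumF-zero {m} λ y → ⟦∧∧false⟧ b (f x y)

  toU-Un : ∀ i k b → toU (Un i k) b ≡ sumF (λ k′ → ⟦ b ∧ sU i k′ ∧ U' i k k′ ⟧)
  toU-Un i k b = sumF-select′ i (λ i′ c → sumF λ k′ → ⟦ b ∧ sU i′ k′ ∧ (c ∧ U' i k k′) ⟧)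
    (λ i′ → sumF-zero λ k′ → ⟦∧∧false⟧ b (sU i′ k′))

  toV-Un : ∀ i k b → toV (Un i k) b ≡ 0
  toV-Un i k b = vanish₂ sV b

  toM-Un : ∀ i k b → toM (Un i k) b ≡ ⟦ b ∧ sM i k (m0 i k) ⟧
  toM-Un i k b =
    trans (sumF-select′ i (λ i′ c → sumF² λ j t → ⟦ b ∧ sM i′ j t ∧ (c ∧ (k == j) ∧ (t == m0 i′ j)) ⟧)
            (λ i′ → vanish₂ (sM i′) b))
    (trans (sumF-select′ k (λ j c → sumF λ t → ⟦ b ∧ sM i j t ∧ (c ∧ (t == m0 i j)) ⟧)
             (λ j → sumF-zero λ t → ⟦∧∧false⟧ b (sM i j t)))
    (trans (sumF-select (m0 i k) (λ t c → ⟦ b ∧ sM i k t ∧ c ⟧) (λ t → ⟦∧∧false⟧ b (sM i k t)))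
           (cong (λ z → ⟦ b ∧ z ⟧) (∧-identityʳ _))))

  toU-Vn : ∀ j k b → toU (Vn j k) b ≡ 0
  toU-Vn j k b = vanish₂ sU b

  toV-Vn : ∀ j k b → toV (Vn j k) b ≡ sumF (λ k′ → ⟦ b ∧ sV j k′ ∧ V' j k k′ ⟧)
  toV-Vn j k b = sumF-select′ j (λ j′ c → sumF λ k′ → ⟦ b ∧ sV j′ k′ ∧ (c ∧ V' j k k′) ⟧)
    (λ j′ → sumF-zero λ k′ → ⟦∧∧false⟧ b (sV j′ k′))

  toM-Vn : ∀ j k b → toM (Vn j k) b ≡ ⟦ b ∧ sM k j (m1 k j) ⟧
  toM-Vn j k b =
    trans (sumF-select′ k (λ i c → sumF² λ j′ t → ⟦ b ∧ sM i j′ t ∧ ((j == j′) ∧ c ∧ (t == m1 i j′)) ⟧)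
            (λ i → sumF-zero λ j′ → sumF-zero λ t → vanish b (sM i j′ t) (j == j′)))
    (trans (sumF-select′ j (λ j′ c → sumF λ t → ⟦ b ∧ sM k j′ t ∧ (c ∧ (t == m1 k j′)) ⟧)
             (λ j′ → sumF-zero λ t → ⟦∧∧false⟧ b (sM k j′ t)))
    (trans (sumF-select (m1 k j) (λ t c → ⟦ b ∧ sM k j t ∧ c ⟧) (λ t → ⟦∧∧false⟧ b (sM k j t)))
           (cong (λ z → ⟦ b ∧ z ⟧) (∧-identityʳ _))))

  toU-Mn : ∀ i j t b → toU (Mn i j t) b ≡ ⟦ b ∧ sU i j ∧ (t == m0 i j) ⟧
  toU-Mn i j t b =
    trans (sumF-select′ i (λ i′ c → sumF λ k → ⟦ b ∧ sU i′ k ∧ (c ∧ (k == j) ∧ (t == m0 i j)) ⟧)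
            (λ i′ → sumF-zero λ k → ⟦∧∧false⟧ b (sU i′ k)))
          (sumF-select j (λ k c → ⟦ b ∧ sU i k ∧ (c ∧ (t == m0 i j)) ⟧) (λ k → ⟦∧∧false⟧ b (sU i k)))

  toV-Mn : ∀ i j t b → toV (Mn i j t) b ≡ ⟦ b ∧ sV j i ∧ (t == m1 i j) ⟧
  toV-Mn i j t b =
    trans (sumF-select′ j (λ j′ c → sumF λ k → ⟦ b ∧ sV j′ k ∧ (c ∧ (k == i) ∧ (t == m1 i j)) ⟧)
            (λ j′ → sumF-zero λ k → ⟦∧∧false⟧ b (sV j′ k)))
          (sumF-select i (λ k c → ⟦ b ∧ sV j k ∧ (c ∧ (t == m1 i j)) ⟧) (λ k → ⟦∧∧false⟧ b (sV j k)))

  toM-Mn : ∀ i j t b → toM (Mn i j t) b ≡ sumF (λ t′ → ⟦ b ∧ sM i j t′ ∧ Mg i j t t′ ⟧)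
  toM-Mn i j t b =
    trans (sumF-select′ i (λ i′ c → sumF² λ j′ t′ → ⟦ b ∧ sM i′ j′ t′ ∧ (c ∧ (j == j′) ∧ Mg i j t t′) ⟧)
            (λ i′ → vanish₂ (sM i′) b))
          (sumF-select′ j (λ j′ c → sumF λ t′ → ⟦ b ∧ sM i j′ t′ ∧ (c ∧ Mg i j t t′) ⟧)
            (λ j′ → sumF-zero λ t′ → ⟦∧∧false⟧ b (sM i j′ t′)))

  arcsU arcsV : Fin n → ℕ
  arcsU i = arcs (U' i) (sU i)
  arcsV j = arcs (V' j) (sV j)

  arcsM : Fin n → Fin n → ℕ
  arcsM i j = arcs (Mg i j) (sM i j)

  linkU linkV : Fin n → Fin n → ℕ
  linkU i j = ⟦ sU i j ∧ sM i j (m0 i j) ⟧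
  linkV i j = ⟦ sV j i ∧ sM i j (m1 i j) ⟧

  private
    from-U : sumF² (λ i k → toU (Un i k) (sU i k) + (toV (Un i k) (sU i k) + toM (Un i k) (sU i k)))
             ≡ sumF arcsU + sumF² linkU
    from-U = trans (sumF²-cong λ i k → cong₂ _+_ (toU-Un i k (sU i k)) (cong₂ _+_ (toV-Un i k (sU i k)) (toM-Un i k (sU i k))))
                   (sumF²-distrib-+ (λ i k → sumF λ k′ → ⟦ sU i k ∧ sU i k′ ∧ U' i k k′ ⟧) linkU)

    from-V : sumF² (λ j k → toU (Vn j k) (sV j k) + (toV (Vn j k) (sV j k) + toM (Vn j k) (sV j k)))
             ≡ sumF arcsV + sumF² linkV
    from-V = trans (sumF²-cong λ j k → cong₂ _+_ (toU-Vn j k (sV j k)) (cong₂ _+_ (toV-Vn j k (sV j k)) (toM-Vn j k (sV j k))))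
             (trans (sumF²-distrib-+ (λ j k → sumF λ k′ → ⟦ sV j k ∧ sV j k′ ∧ V' j k k′ ⟧) (λ j k → linkV k j))
                    (cong (sumF arcsV +_) (sumF-comm (λ j k → linkV k j))))

    link-collapse : ∀ (x : Fin (n * n) → Bool) y a → sumF (λ t → ⟦ x t ∧ y ∧ (t == a) ⟧) ≡ ⟦ y ∧ x a ⟧
    link-collapse x y a = trans (sumF-select a (λ t c → ⟦ x t ∧ y ∧ c ⟧) (λ t → ⟦∧∧false⟧ (x t) y))
      (cong ⟦_⟧ (trans (cong (x a ∧_) (∧-identityʳ y)) (∧-comm (x a) y)))

    from-M : sumF² (λ i j → sumF λ t → toU (Mn i j t) (sM i j t) + (toV (Mn i j t) (sM i j t) + toM (Mn i j t) (sM i j t)))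
             ≡ sumF² linkU + (sumF² linkV + sumF² arcsM)
    from-M = trans (sumF²-cong λ i j →
        trans (sumF-cong λ t → cong₂ _+_ (toU-Mn i j t (sM i j t)) (cong₂ _+_ (toV-Mn i j t (sM i j t)) (toM-Mn i j t (sM i j t))))
        (trans (sumF-distrib-+ (λ t → ⟦ sM i j t ∧ sU i j ∧ (t == m0 i j) ⟧) _)
          (cong₂ _+_ (link-collapse (sM i j) (sU i j) (m0 i j))
            (trans (sumF-distrib-+ (λ t → ⟦ sM i j t ∧ sV j i ∧ (t == m1 i j) ⟧) _)
                   (cong (_+ arcsM i j) (link-collapse (sM i j) (sV j i) (m1 i j)))))))
      (trans (sumF²-distrib-+ linkU _) (cong (sumF² linkU +_) (sumF²-distrib-+ linkV arcsM)))

  arcs-graph : arcs graph s ≡ (sumF arcsU + (sumF arcsV + sumF² arcsM)) + 2 * (sumF² linkU + sumF² linkV)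
  arcs-graph = trans arcs-graph-split (trans (cong₂ _+_ from-U (cong₂ _+_ from-V from-M))
    (regroup (sumF arcsU) (sumF arcsV) (sumF² arcsM) (sumF² linkU) (sumF² linkV)))
    where
    regroup : ∀ aU aV aM lU lV → (aU + lU) + ((aV + lV) + (lU + (lV + aM))) ≡ (aU + (aV + aM)) + 2 * (lU + lV)
    regroup = solve-∀

  count-graph : count s ≡ sumF (count ∘ sU) + (sumF (count ∘ sV) + sumF² (λ i j → count (sM i j)))
  count-graph = trans (count≡sumF s) (trans (sumF-encode {n} (⟦_⟧ ∘ s))
    (sym (cong₂ _+_ (sumF-cong λ i → count≡sumF (sU i))
      (cong₂ _+_ (sumF-cong λ j → count≡sumF (sV j)) (sumF²-cong λ i j → count≡sumF (sM i j))))))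

if-simple : ∀ {k} b {A B : Adj k} → IsSimple A → IsSimple B → IsSimple (if b then A else B)
if-simple true  A-simple _ = A-simple
if-simple false _ B-simple = B-simple

guarded-sym : ∀ {k} (i i′ : Fin k) {x y : Bool} → (i ≡ i′ → x ≡ y) → (i == i′) ∧ x ≡ (i′ == i) ∧ y
guarded-sym i i′ x≡y rewrite ==-sym i′ i with i == i′ in i=i′
... | true  = x≡y (==⇒≡ i=i′)
... | false = refl

module _ {d n M u v} (C : Construction d n M u v) where
  open Construction C

  U'-simple : ∀ i → IsSimple (U' i)
  U'-simple i = if-simple (u i) (proj₁ (Ug-ok i)) (removeEdge-simple _ _ _ (removeEdge-simple _ _ _ (proj₁ (Ug-ok i))))

  V'-simple : ∀ j → IsSimple (V' j)
  V'-simple j = if-simple (v j) (proj₁ (Vg-ok j)) (removeEdge-simple _ _ _ (removeEdge-simple _ _ _ (proj₁ (Vg-ok j))))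

  Mg-simple : ∀ i j → IsSimple (Mg i j)
  Mg-simple i j = if-simple (M i j) (removeEdge-simple _ _ _ (proj₁ (K-ok i j)))
                    (removeEdge-simple _ _ _ (removeEdge-simple _ _ _ (proj₁ (K-ok i j))))

  adjGV-sym : ∀ a b → adjGV a b ≡ adjGV b a
  adjGV-sym (Un i k)   (Un i′ k′)   = guarded-sym i i′ λ { refl → proj₁ (U'-simple i) k k′ }
  adjGV-sym (Un i k)   (Vn _ _)     = refl
  adjGV-sym (Un i k)   (Mn i′ j t)  = guarded-sym i i′ λ _ → refl
  adjGV-sym (Vn _ _)   (Un _ _)     = refl
  adjGV-sym (Vn j k)   (Vn j′ k′)   = guarded-sym j j′ λ { refl → proj₁ (V'-simple j) k k′ }
  adjGV-sym (Vn j k)   (Mn i j′ t)  = guarded-sym j j′ λ _ → refl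
  adjGV-sym (Mn i j t) (Un i′ k)    = guarded-sym i i′ λ _ → refl
  adjGV-sym (Mn i j t) (Vn j′ k)    = guarded-sym j j′ λ _ → refl
  adjGV-sym (Mn i j t) (Mn i′ j′ t′) =
    guarded-sym i i′ λ { refl → guarded-sym j j′ λ { refl → proj₁ (Mg-simple i j) t t′ } }

  adjGV-irrefl : ∀ a → adjGV a a ≡ false
  adjGV-irrefl (Un i k)   rewrite ==-refl i = proj₂ (U'-simple i) k
  adjGV-irrefl (Vn j k)   rewrite ==-refl j = proj₂ (V'-simple j) k
  adjGV-irrefl (Mn i j t) rewrite ==-refl i | ==-refl j = proj₂ (Mg-simple i j) t

  graph-simple : IsSimple graph
  graph-simple = (λ x y → adjGV-sym (decode x) (decode y)) , (adjGV-irrefl ∘ decode)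

-- Density

-- O = 2|E(S)| and A = |S|; B counts the deficient vector gadgets meeting S and G the matrix gadgets
-- selected whole, with M_ij = 1 and both links in S.
density-arith : ∀ n D O A B G → 1 ≤ A → O + 4 * B ≤ D * A + 2 * G → G ≤ n * B → n * n * G ≤ A →
  (n * n + 2 * n) * O < ((n * n + 2 * n) * D + 2) * A
density-arith n D O A B zero 1≤A O+4B≤ _ _ = begin-strict
  c * O                 ≤⟨ *-monoʳ-≤ c (≤-trans (m≤m+n O (4 * B)) (≤-trans O+4B≤ (≤-reflexive (+-identityʳ _)))) ⟩
  c * (D * A)           ≡⟨ *-assoc c D A ⟨
  c * D * A             <⟨ m<m+n (c * D * A) (≤-trans 1≤A (m≤m+n A _)) ⟩
  c * D * A + 2 * A     ≡⟨ *-distribʳ-+ A (c * D) 2 ⟨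
  (c * D + 2) * A       ∎
  where
  open ≤-Reasoning
  c : ℕ
  c = n * n + 2 * n
density-arith n D O A B G@(suc _) _ O+4B≤ G≤nB n²G≤A = begin-strict
  c * O                  <⟨ m<m+n (c * O) (≤-trans (≤-trans (s≤s z≤n) G≤nB) (m≤n*m (n * B) 8)) ⟩
  c * O + 8 * (n * B)    ≤⟨ +-cancelʳ-≤ (4 * (n * n * B)) _ _ scaled ⟩
  c * D * A + 2 * A      ≡⟨ *-distribʳ-+ A (c * D) 2 ⟨
  (c * D + 2) * A        ∎
  where
  open ≤-Reasoning
  c : ℕ
  c = n * n + 2 * n
  expand-left : ∀ n O B → (n * n + 2 * n) * (O + 4 * B) ≡ (n * n + 2 * n) * O + 8 * (n * B) + 4 * (n * n * B)
  expand-left = solve-∀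
  expand-right : ∀ n D A G →
    (n * n + 2 * n) * (D * A + 2 * G) ≡ (n * n + 2 * n) * D * A + (2 * (n * n * G) + 4 * (n * G))
  expand-right = solve-∀
  nG≤nnB : 4 * (n * G) ≤ 4 * (n * n * B)
  nG≤nnB = *-monoʳ-≤ 4 (≤-trans (*-monoʳ-≤ n G≤nB) (≤-reflexive (sym (*-assoc n n B))))
  scaled : c * O + 8 * (n * B) + 4 * (n * n * B) ≤ c * D * A + 2 * A + 4 * (n * n * B)
  scaled = begin
    c * O + 8 * (n * B) + 4 * (n * n * B)           ≡⟨ expand-left n O B ⟨
    c * (O + 4 * B)                                 ≤⟨ *-monoʳ-≤ c O+4B≤ ⟩
    c * (D * A + 2 * G)                             ≡⟨ expand-right n D A G ⟩
    c * D * A + (2 * (n * n * G) + 4 * (n * G))     ≤⟨ +-monoʳ-≤ (c * D * A) (+-mono-≤ (*-monoʳ-≤ 2 n²G≤A) nG≤nnB) ⟩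
    c * D * A + (2 * A + 4 * (n * n * B))           ≡⟨ +-assoc (c * D * A) (2 * A) _ ⟨
    c * D * A + 2 * A + 4 * (n * n * B)             ∎

-- A full link at M_ij = 1 with uMv = 0 forces u_i = 0 or v_j = 0, at a vector gadget meeting S.
full-link≤deficiency : ∀ a m su sv ui vj au av → ui ∧ m ∧ vj ≡ false →
  (su ≡ true → au ≡ true) → (sv ≡ true → av ≡ true) →
  ⟦ a ∧ m ∧ su ∧ sv ⟧ ≤ ⟦ au ∧ not ui ⟧ + ⟦ av ∧ not vj ⟧
full-link≤deficiency true true true true ui vj au av no-path su⇒au sv⇒av
  rewrite su⇒au refl | sv⇒av refl = deficient ui vj no-path
  where
  deficient : ∀ ui vj → ui ∧ true ∧ vj ≡ false → 1 ≤ ⟦ not ui ⟧ + ⟦ not vj ⟧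
  deficient true  true  ()
  deficient true  false _ = s≤s z≤n
  deficient false _     _ = s≤s z≤n
full-link≤deficiency false _     _     _     _ _ _ _ _ _ _ = z≤n
full-link≤deficiency true  false _     _     _ _ _ _ _ _ _ = z≤n
full-link≤deficiency true  true  false _     _ _ _ _ _ _ _ = z≤n
full-link≤deficiency true  true  true  false _ _ _ _ _ _ _ = z≤n

module Sparse {d n M u v} (C : Construction d n M u v) (uMv≡0 : boolProd u M v ≡ false)
              (S : Subset (size n)) (S≢∅ : Nonempty S) where
  open Construction C
  open Decomposition C (lookup S)

  deficientU deficientV : Fin n → Bool
  deficientU i = anyF (sU i) ∧ not (u i)
  deficientV j = anyF (sV j) ∧ not (v j)

  fullLink : Fin n → Fin n → ℕ
  fullLink i j = ⟦ allF (sM i j) ∧ M i j ∧ sU i j ∧ sV j i ⟧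

  B G A : ℕ
  B = sumF (⟦_⟧ ∘ deficientU) + sumF (⟦_⟧ ∘ deficientV)
  G = sumF² fullLink
  A = sumF (count ∘ sU) + (sumF (count ∘ sV) + sumF² (λ i j → count (sM i j)))

  vector-bound-U : sumF arcsU + 4 * sumF (⟦_⟧ ∘ deficientU) ≤ 2 * d * sumF (count ∘ sU)
  vector-bound-U = ≤-trans
    (sumF-mono-+* 4 arcsU (⟦_⟧ ∘ deficientU) (λ i → 2 * d * count (sU i)) λ i →
      vector-gadget-bound {d = d} (Ug-ok i) (u i) (ua i) (ub i) (uc i) (ue i) (u-edge1 i) (u-edge2 i) (sU i))
    (≤-reflexive (sym (*-distribˡ-sumF (2 * d) (count ∘ sU))))

  vector-bound-V : sumF arcsV + 4 * sumF (⟦_⟧ ∘ deficientV) ≤ 2 * d * sumF (count ∘ sV)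
  vector-bound-V = ≤-trans
    (sumF-mono-+* 4 arcsV (⟦_⟧ ∘ deficientV) (λ j → 2 * d * count (sV j)) λ j →
      vector-gadget-bound {d = d} (Vg-ok j) (v j) (va j) (vb j) (vc j) (ve j) (v-edge1 j) (v-edge2 j) (sV j))
    (≤-reflexive (sym (*-distribˡ-sumF (2 * d) (count ∘ sV))))

  matrix-bound : sumF² arcsM + 2 * (sumF² linkU + sumF² linkV)
    ≤ 2 * d * sumF² (λ i j → count (sM i j)) + 2 * G
  matrix-bound = begin
    sumF² arcsM + 2 * (sumF² linkU + sumF² linkV)
      ≡⟨ cong (λ x → sumF² arcsM + 2 * x) (sumF²-distrib-+ linkU linkV) ⟨
    sumF² arcsM + 2 * sumF² (λ i j → linkU i j + linkV i j)
      ≤⟨ sumF²-mono-+* 2 arcsM (λ i j → linkU i j + linkV i j) (λ i j → 2 * d * count (sM i j) + 2 * fullLink i j) (λ i j →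
           matrix-gadget-bound {d = d} (K-ok i j) (m0 i j) (m1 i j) (m-edge i j) (M i j) (r0 i j) (r1 i j) (r-edge i j)
             (sM i j) (sU i j) (sV j i)) ⟩
    sumF² (λ i j → 2 * d * count (sM i j) + 2 * fullLink i j)
      ≡⟨ sumF²-distrib-+ (λ i j → 2 * d * count (sM i j)) (λ i j → 2 * fullLink i j) ⟩
    sumF² (λ i j → 2 * d * count (sM i j)) + sumF² (λ i j → 2 * fullLink i j)
      ≡⟨ cong₂ _+_ (*-distribˡ-sumF² (2 * d) (λ i j → count (sM i j))) (*-distribˡ-sumF² 2 fullLink) ⟨
    2 * d * sumF² (λ i j → count (sM i j)) + 2 * G ∎
    where open ≤-Reasoning

  arcs+deficiency≤ : arcs graph (lookup S) + 4 * B ≤ 2 * d * A + 2 * G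
  arcs+deficiency≤ = begin
    arcs graph (lookup S) + 4 * B
      ≡⟨ cong (_+ 4 * B) arcs-graph ⟩
    (sumF arcsU + (sumF arcsV + sumF² arcsM)) + 2 * (sumF² linkU + sumF² linkV) + 4 * B
      ≡⟨ regroup (sumF arcsU) (sumF arcsV) (sumF² arcsM) (sumF² linkU) (sumF² linkV)
                 (sumF (⟦_⟧ ∘ deficientU)) (sumF (⟦_⟧ ∘ deficientV)) ⟩
    (sumF arcsU + 4 * sumF (⟦_⟧ ∘ deficientU))
      + ((sumF arcsV + 4 * sumF (⟦_⟧ ∘ deficientV)) + (sumF² arcsM + 2 * (sumF² linkU + sumF² linkV)))
      ≤⟨ +-mono-≤ vector-bound-U (+-mono-≤ vector-bound-V matrix-bound) ⟩
    2 * d * sumF (count ∘ sU) + (2 * d * sumF (count ∘ sV) + (2 * d * sumF² (λ i j → count (sM i j)) + 2 * G))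
      ≡⟨ factor (2 * d) (sumF (count ∘ sU)) (sumF (count ∘ sV)) _ G ⟩
    2 * d * A + 2 * G ∎
    where
    open ≤-Reasoning
    regroup : ∀ aU aV aM lU lV bU bV → (aU + (aV + aM)) + 2 * (lU + lV) + 4 * (bU + bV)
      ≡ (aU + 4 * bU) + ((aV + 4 * bV) + (aM + 2 * (lU + lV)))
    regroup = solve-∀
    factor : ∀ D a b c g → D * a + (D * b + (D * c + 2 * g)) ≡ D * (a + (b + c)) + 2 * g
    factor = solve-∀

  fullLinks≤deficiency : G ≤ n * B
  fullLinks≤deficiency = begin
    G                                                             ≤⟨ sumF²-mono pointwise ⟩
    sumF² (λ i j → ⟦ deficientU i ⟧ + ⟦ deficientV j ⟧)           ≡⟨ sumF²-separable (⟦_⟧ ∘ deficientU) (⟦_⟧ ∘ deficientV) ⟩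
    n * sumF (⟦_⟧ ∘ deficientU) + n * sumF (⟦_⟧ ∘ deficientV)     ≡⟨ *-distribˡ-+ n _ _ ⟨
    n * B                                                         ∎
    where
    open ≤-Reasoning
    no-path : ∀ i j → u i ∧ M i j ∧ v j ≡ false
    no-path i j = anyF-false _ (anyF-false _ uMv≡0 i) j
    pointwise : ∀ i j → fullLink i j ≤ ⟦ deficientU i ⟧ + ⟦ deficientV j ⟧
    pointwise i j = full-link≤deficiency (allF (sM i j)) (M i j) (sU i j) (sV j i) (u i) (v j)
      (anyF (sU i)) (anyF (sV j)) (no-path i j) (anyF-intro (sU i) j) (anyF-intro (sV j) i)

  fullLinks≤size : n * n * G ≤ A
  fullLinks≤size = begin
    n * n * G                                   ≡⟨ *-distribˡ-sumF² (n * n) fullLink ⟩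
    sumF² (λ i j → n * n * fullLink i j)        ≤⟨ sumF²-mono pointwise ⟩
    sumF² (λ i j → count (sM i j))              ≤⟨ ≤-trans (m≤n+m _ (sumF (count ∘ sV))) (m≤n+m _ (sumF (count ∘ sU))) ⟩
    A                                           ∎
    where
    open ≤-Reasoning
    pointwise : ∀ i j → n * n * fullLink i j ≤ count (sM i j)
    pointwise i j with allF (sM i j) in all
    ... | false = ≤-trans (≤-reflexive (*-zeroʳ (n * n))) z≤n
    ... | true  = ≤-trans (*-monoʳ-≤ (n * n) (⟦⟧≤1 (M i j ∧ sU i j ∧ sV j i)))
                    (≤-reflexive (trans (*-identityʳ (n * n)) (sym (count-all (allF-true all)))))

  A≡∣S∣ : A ≡ ∣ S ∣
  A≡∣S∣ = trans (sym count-graph) (count≡∣∣ S)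

  1≤A : 1 ≤ A
  1≤A = ≤-trans (≤-reflexive (cong ⟦_⟧ (sym ([]=⇒lookup (proj₂ S≢∅)))))
    (≤-trans (≤-sumF (⟦_⟧ ∘ lookup S) (proj₁ S≢∅)) (≤-reflexive (trans (sym (count≡sumF (lookup S))) count-graph)))

  sparse : (n * n + 2 * n) * edgesIn graph S < (d * (n * n + 2 * n) + 1) * ∣ S ∣
  sparse = *-cancelˡ-< 2 _ _ (begin-strict
    2 * (c * E)               ≡⟨ double c E ⟩
    c * (E + E)               ≡⟨ cong (c *_) (edgesIn-handshake graph S (graph-simple C)) ⟩
    c * arcs graph (lookup S) <⟨ density-arith n (2 * d) _ A B G 1≤A arcs+deficiency≤ fullLinks≤deficiency fullLinks≤size ⟩
    (c * (2 * d) + 2) * A     ≡⟨ cong (λ a → (c * (2 * d) + 2) * a) A≡∣S∣ ⟩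
    (c * (2 * d) + 2) * ∣ S ∣ ≡⟨ halve c d ∣ S ∣ ⟩
    2 * ((d * c + 1) * ∣ S ∣) ∎)
    where
    open ≤-Reasoning
    c E : ℕ
    c = n * n + 2 * n
    E = edgesIn graph S
    double : ∀ c E → 2 * (c * E) ≡ c * (E + E)
    double = solve-∀
    halve : ∀ c d a → (c * (2 * d) + 2) * a ≡ 2 * ((d * c + 1) * a)
    halve = solve-∀

module Dense {d n M u v} (C : Construction d n M u v) (i j : Fin n)
             (uᵢ : u i ≡ true) (Mᵢⱼ : M i j ≡ true) (vⱼ : v j ≡ true) where
  open Construction C

  chosen : GV n → Bool
  chosen (Un i′ _)    = i′ == i
  chosen (Vn j′ _)    = j′ == j
  chosen (Mn i′ j′ _) = (i′ == i) ∧ (j′ == j)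

  S : Subset (size n)
  S = tabulate (chosen ∘ decode)

  open Decomposition C (lookup S)

  lookup-S : ∀ a → lookup S (encode a) ≡ chosen a
  lookup-S a = trans (lookup∘tabulate (chosen ∘ decode) (encode a)) (cong chosen (decode-encode a))

  Uᵢ⊆S : ∀ k → sU i k ≡ true
  Uᵢ⊆S k = trans (lookup-S (Un i k)) (==-refl i)

  Vⱼ⊆S : ∀ k → sV j k ≡ true
  Vⱼ⊆S k = trans (lookup-S (Vn j k)) (==-refl j)

  Mᵢⱼ⊆S : ∀ t → sM i j t ≡ true
  Mᵢⱼ⊆S t = trans (lookup-S (Mn i j t)) (cong₂ _∧_ (==-refl i) (==-refl j))

  ∣S∣≡ : ∣ S ∣ ≡ n * n + 2 * n
  ∣S∣≡ = begin
    ∣ S ∣                                                                    ≡⟨ trans (sym (count≡∣∣ S)) count-graph ⟩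
    sumF (count ∘ sU) + (sumF (count ∘ sV) + sumF² (λ i′ j′ → count (sM i′ j′)))
      ≡⟨ cong₂ _+_ (sumF-cong λ i′ → trans (count-cong (lookup-S ∘ Un i′)) (count-const {n} (i′ == i)))
          (cong₂ _+_ (sumF-cong λ j′ → trans (count-cong (lookup-S ∘ Vn j′)) (count-const {n} (j′ == j)))
                     (sumF²-cong λ i′ j′ → trans (count-cong (lookup-S ∘ Mn i′ j′)) (count-const {n * n} ((i′ == i) ∧ (j′ == j))))) ⟩
    sumF (λ i′ → n * ⟦ i′ == i ⟧) + (sumF (λ j′ → n * ⟦ j′ == j ⟧) + sumF² (λ i′ j′ → n * n * ⟦ (i′ == i) ∧ (j′ == j) ⟧))
      ≡⟨ cong₂ _+_ (trans (sym (*-distribˡ-sumF n (λ i′ → ⟦ i′ == i ⟧))) (cong (n *_) (indicator i)))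
          (cong₂ _+_ (trans (sym (*-distribˡ-sumF n (λ j′ → ⟦ j′ == j ⟧))) (cong (n *_) (indicator j)))
                     (trans (sym (*-distribˡ-sumF² (n * n) (λ i′ j′ → ⟦ (i′ == i) ∧ (j′ == j) ⟧)))
                            (cong (n * n *_) (sumF²-indicator i j)))) ⟩
    n * 1 + (n * 1 + n * n * 1)                                             ≡⟨ tidy n ⟩
    n * n + 2 * n                                                           ∎
    where
    open ≡-Reasoning
    indicator : ∀ (a : Fin n) → sumF (λ x → ⟦ x == a ⟧) ≡ 1
    indicator a = sumF-select a (λ _ c → ⟦ c ⟧) (λ _ → refl)
    tidy : ∀ n → n * 1 + (n * 1 + n * n * 1) ≡ n * n + 2 * n
    tidy = solve-∀

  private
    c : ℕ
    c = n * n + 2 * n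

    Ug-regular : Regular (2 * d) (Ug i)
    Ug-regular = proj₁ (proj₂ (Ug-ok i))
    Vg-regular : Regular (2 * d) (Vg j)
    Vg-regular = proj₁ (proj₂ (Vg-ok j))
    K-regular : Regular (2 * d) (K i j)
    K-regular = proj₁ (proj₂ (K-ok i j))

  arcsUᵢ : arcsU i ≡ 2 * d * n
  arcsUᵢ = begin
    arcs (U' i) (sU i)       ≡⟨ cong (λ b → arcs (if b then Ug i else _) (sU i)) uᵢ ⟩
    arcs (Ug i) (sU i)       ≡⟨ arcs-regular Ug-regular Uᵢ⊆S ⟩
    2 * d * count (sU i)     ≡⟨ cong (2 * d *_) (count-all Uᵢ⊆S) ⟩
    2 * d * n                ∎
    where open ≡-Reasoning

  arcsVⱼ : arcsV j ≡ 2 * d * n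
  arcsVⱼ = begin
    arcs (V' j) (sV j)       ≡⟨ cong (λ b → arcs (if b then Vg j else _) (sV j)) vⱼ ⟩
    arcs (Vg j) (sV j)       ≡⟨ arcs-regular Vg-regular Vⱼ⊆S ⟩
    2 * d * count (sV j)     ≡⟨ cong (2 * d *_) (count-all Vⱼ⊆S) ⟩
    2 * d * n                ∎
    where open ≡-Reasoning

  arcsMᵢⱼ : 2 + arcsM i j ≡ 2 * d * (n * n)
  arcsMᵢⱼ = begin
    2 + arcs (Mg i j) (sM i j)      ≡⟨ cong (λ b → 2 + arcs (if b then K′ else _) (sM i j)) Mᵢⱼ ⟩
    2 + arcs K′ (sM i j)            ≡⟨ cong (2 +_) (arcs-all K′ Mᵢⱼ⊆S) ⟩
    2 + arcs K′ (const true)        ≡⟨ arcs-removeEdge (K i j) (m0 i j) (m1 i j) (proj₁ (K-ok i j)) (m-edge i j) ⟨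
    arcs (K i j) (const true)       ≡⟨ arcs-all (K i j) Mᵢⱼ⊆S ⟨
    arcs (K i j) (sM i j)           ≡⟨ arcs-regular K-regular Mᵢⱼ⊆S ⟩
    2 * d * count (sM i j)          ≡⟨ cong (2 * d *_) (count-all Mᵢⱼ⊆S) ⟩
    2 * d * (n * n)                 ∎
    where
    open ≡-Reasoning
    K′ : Adj (n * n)
    K′ = removeEdge (K i j) (m0 i j) (m1 i j)

  linkUᵢⱼ : linkU i j ≡ 1
  linkUᵢⱼ = cong ⟦_⟧ (cong₂ _∧_ (Uᵢ⊆S j) (Mᵢⱼ⊆S (m0 i j)))

  linkVᵢⱼ : linkV i j ≡ 1
  linkVᵢⱼ = cong ⟦_⟧ (cong₂ _∧_ (Vⱼ⊆S i) (Mᵢⱼ⊆S (m1 i j)))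

  local≤arcs : (arcsU i + (arcsV j + arcsM i j)) + 2 * (linkU i j + linkV i j) ≤ arcs graph (lookup S)
  local≤arcs = ≤-trans
    (+-mono-≤ (+-mono-≤ (≤-sumF arcsU i) (+-mono-≤ (≤-sumF arcsV j) (≤-sumF² arcsM i j)))
              (*-monoʳ-≤ 2 (+-mono-≤ (≤-sumF² linkU i j) (≤-sumF² linkV i j))))
    (≤-reflexive (sym arcs-graph))

  arcs≥ : 2 * d * c + 2 ≤ arcs graph (lookup S)
  arcs≥ = +-cancelˡ-≤ 2 _ _ (begin
    2 + (2 * d * c + 2)
      ≡⟨ expand (2 * d) n ⟩
    (2 * d * n + (2 * d * n + 2 * d * (n * n))) + 2 * (1 + 1)
      ≡⟨ cong₂ (λ a m → (a + (2 * d * n + m)) + 2 * (1 + 1)) arcsUᵢ arcsMᵢⱼ ⟨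
    (arcsU i + (2 * d * n + (2 + arcsM i j))) + 2 * (1 + 1)
      ≡⟨ cong₂ (λ b l → (arcsU i + (b + (2 + arcsM i j))) + 2 * l) arcsVⱼ (cong₂ _+_ linkUᵢⱼ linkVᵢⱼ) ⟨
    (arcsU i + (arcsV j + (2 + arcsM i j))) + 2 * (linkU i j + linkV i j)
      ≡⟨ shift (arcsU i) (arcsV j) (arcsM i j) (linkU i j + linkV i j) ⟩
    2 + ((arcsU i + (arcsV j + arcsM i j)) + 2 * (linkU i j + linkV i j))
      ≤⟨ +-monoʳ-≤ 2 local≤arcs ⟩
    2 + arcs graph (lookup S) ∎)
    where
    open ≤-Reasoning
    expand : ∀ D n → 2 + (D * (n * n + 2 * n) + 2) ≡ (D * n + (D * n + D * (n * n))) + 2 * (1 + 1)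
    expand = solve-∀
    shift : ∀ a b m l → (a + (b + (2 + m))) + 2 * l ≡ 2 + ((a + (b + m)) + 2 * l)
    shift = solve-∀

  dense : DensityAtLeast graph (d * c + 1) c
  dense = S , (encode (Un i i) , lookup⇒[]= (encode (Un i i)) S (Uᵢ⊆S i)) , (begin
    (d * c + 1) * ∣ S ∣     ≡⟨ cong ((d * c + 1) *_) ∣S∣≡ ⟩
    (d * c + 1) * c         ≡⟨ *-comm (d * c + 1) c ⟩
    c * (d * c + 1)         ≤⟨ *-monoʳ-≤ c (*-cancelˡ-≤ 2 (≤-trans (≤-reflexive (double d c)) (≤-trans arcs≥ (≤-reflexive E+E)))) ⟩
    c * E                   ∎)
    where
    open ≤-Reasoning
    E : ℕ
    E = edgesIn graph S
    E+E : arcs graph (lookup S) ≡ 2 * E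
    E+E = trans (sym (edgesIn-handshake graph S (graph-simple C))) (cong (E +_) (sym (+-identityʳ E)))
    double : ∀ d c → 2 * (d * c + 1) ≡ 2 * d * c + 2
    double = solve-∀

lemma46 : (d n : ℕ) → 3 ≤ d → 1 ≤ n →
    (M : Fin n → Fin n → Bool) (u v : Fin n → Bool) →
    (C : Construction d n M u v) →
      (boolProd u M v ≡ true →
        DensityAtLeast (Construction.graph C) (d * (n * n + 2 * n) + 1) (n * n + 2 * n))
      × (boolProd u M v ≡ false →
        DensityBelow (Construction.graph C) (d * (n * n + 2 * n) + 1) (n * n + 2 * n))
lemma46 d n _ _ M u v C = dense-if-path , sparse-if-no-path
  where
  dense-if-path : boolProd u M v ≡ true →
    DensityAtLeast (Construction.graph C) (d * (n * n + 2 * n) + 1) (n * n + 2 * n)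
  dense-if-path uMv≡1 =
    let i , row = anyF-witness _ uMv≡1
        j , path = anyF-witness _ row
    in Dense.dense C i j (∧-conicalˡ (u i) _ path) (∧-conicalˡ (M i j) _ (∧-conicalʳ (u i) _ path))
                         (∧-conicalʳ (M i j) _ (∧-conicalʳ (u i) _ path))
  sparse-if-no-path : boolProd u M v ≡ false →
    DensityBelow (Construction.graph C) (d * (n * n + 2 * n) + 1) (n * n + 2 * n)
  sparse-if-no-path uMv≡0 S S≢∅ = Sparse.sparse C uMv≡0 S S≢∅
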